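{- Let $A$ be a set equipped with the trivial partial order (no two distinct elements comparable), and let $A'=A\cup\{e\}$, $e\notin A$, be its raising augmentation ($e<x$ for all $x\in A$, and no other relations besides reflexivity). Then the induced order $\le_e$ on $A^*$ is the morphological order: for $v,w\in A^*$, $v\le_e w$ if and only if $w$ can be obtained from $v$ by inserting some (possibly zero) letters of $A$.
   Context: All order relations are reflexive. For a set $X$, $X^*$ is the free monoid of finite words over $X$; $|w|$ is the length and $w_i$ the $i$-th letter of a word $w$. For $w\in A^*$, an $e$-extension of $w$ is a word in $A'^*$ obtained from $w$ by inserting finitely many (possibly zero) copies of $e$ at arbitrary positions. The induced order on $A^*$: $v\le_e w$ iff there exist $e$-extensions $v'$ of $v$ and $w'$ of $w$ with $|v'|=|w'|=n$ and $v'_i\le w'_i$ in $A'$ for all $i=1,\dots,n$. -}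

module Defs where

open import Level using (Level)
open import Data.List using (List; []; _∷_; length; map; lookup)
open import Data.Maybe using (Maybe; just; nothing)
open import Data.Fin using (Fin)
open import Data.Product using (Σ; _×_; ∃-syntax)
open import Relation.Binary.PropositionalEquality using (_≡_; subst)

private variable
  a : Level

Aug : Set a → Set a
Aug A = Maybe A

e : {A : Set a} → Aug A
e = nothing

data _≤'_ {A : Set a} : Aug A → Aug A → Set a where
  e≤ : ∀ (x : Aug A) → e ≤' x
  refl-A : ∀ (x : A) → just x ≤' just x

data IsEExt {A : Set a} : List A → List (Aug A) → Set a where
  []   : IsEExt [] []
  keep : ∀ {x w w'} → IsEExt w w' → IsEExt (x ∷ w) (just x ∷ w')
  ins  : ∀ {w w'} → IsEExt w w' → IsEExt w (e ∷ w')

_≤ₑ_ : {A : Set a} → List A → List A → Set a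
_≤ₑ_ {A = A} v w =
  Σ (List (Aug A)) λ v' → Σ (List (Aug A)) λ w' →
    IsEExt v v' × IsEExt w w' ×
    Σ (length v' ≡ length w') λ eq →
      ∀ (i : Fin (length v')) →
        lookup v' i ≤' lookup w' (subst Fin eq i)

data Inserts {A : Set a} : List A → List A → Set a where
  []   : Inserts [] []
  keep : ∀ {x v w} → Inserts v w → Inserts (x ∷ v) (x ∷ w)
  ins  : ∀ {x v w} → Inserts v w → Inserts v (x ∷ w)

_≤ₘ_ : {A : Set a} → List A → List A → Set a
v ≤ₘ w = Inserts v w

-- Pad v and w with e to equal-length words v', w' compared letterwise. A letter
-- of A can only sit over the same letter, so the e's of v' over letters of w'
-- are exactly the inserted letters, while e over e is padding that can be
-- dropped. Conversely, an insertion is realised by putting e in v' below it.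
module Submission where

open import Defs
open import Level using (Level)
open import Data.List using (List; []; _∷_; length; lookup)
open import Data.List.Relation.Binary.Pointwise
  using (Pointwise; []; _∷_; Pointwise-length; lookup-cast; lookup⁻)
open import Data.Maybe using (just)
open import Data.Fin using (Fin; toℕ)
open import Data.Fin.Properties using (subst-is-cast; toℕ-cast; toℕ-injective)
open import Data.Product using (∃₂; _×_; _,_)
open import Function.Bundles using (_⇔_; mk⇔)
open import Function.Properties.Equivalence using () renaming (trans to ⇔-trans)
open import Relation.Binary.Core using (REL)
open import Relation.Binary.PropositionalEquality using (_≡_; subst; trans)

module _ {a b r : Level} {A : Set a} {B : Set b} {R : REL A B r} where

  Pointwise⇒lookup-subst : ∀ {xs ys} → Pointwise R xs ys →
    (eq : length xs ≡ length ys) →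
    ∀ i → R (lookup xs i) (lookup ys (subst Fin eq i))
  Pointwise⇒lookup-subst xs∼ys eq i
    rewrite subst-is-cast eq i = lookup-cast xs∼ys eq i

  lookup-subst⇒Pointwise : ∀ {xs ys} (eq : length xs ≡ length ys) →
    (∀ i → R (lookup xs i) (lookup ys (subst Fin eq i))) →
    Pointwise R xs ys
  lookup-subst⇒Pointwise {xs} {ys} eq R-at = lookup⁻ eq R-at-same-index
    where
    R-at-same-index : ∀ {i j} → toℕ i ≡ toℕ j → R (lookup xs i) (lookup ys j)
    R-at-same-index {i} {j} i≡j = subst (λ k → R (lookup xs i) (lookup ys k))
      (toℕ-injective (trans (toℕ-subst i) i≡j)) (R-at i)
      where
      toℕ-subst : ∀ i → toℕ (subst Fin eq i) ≡ toℕ i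
      toℕ-subst i rewrite subst-is-cast eq i = toℕ-cast eq i

module _ {a : Level} {A : Set a} where

  EAligned : List A → List A → Set a
  EAligned v w = ∃₂ λ v' w' → IsEExt v v' × IsEExt w w' × Pointwise _≤'_ v' w'

  ≤ₑ⇔EAligned : ∀ {v w : List A} → (v ≤ₑ w) ⇔ EAligned v w
  ≤ₑ⇔EAligned = mk⇔
    (λ (v' , w' , ev , ew , eq , v'≤w') →
       v' , w' , ev , ew , lookup-subst⇒Pointwise eq v'≤w')
    (λ (v' , w' , ev , ew , v'≤w') →
       let eq = Pointwise-length v'≤w' in
       v' , w' , ev , ew , eq , Pointwise⇒lookup-subst v'≤w' eq)

  EAligned⇒Inserts : ∀ {v w : List A} {v' w'} → IsEExt v v' → IsEExt w w' →
    Pointwise _≤'_ v' w' → Inserts v w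
  EAligned⇒Inserts []        []        []               = []
  EAligned⇒Inserts (keep ev) (keep ew) (refl-A _ ∷ v'≤w') = keep (EAligned⇒Inserts ev ew v'≤w')
  EAligned⇒Inserts (ins ev)  (keep ew) (e≤ _ ∷ v'≤w')     = ins (EAligned⇒Inserts ev ew v'≤w')
  EAligned⇒Inserts (ins ev)  (ins ew)  (e≤ _ ∷ v'≤w')     = EAligned⇒Inserts ev ew v'≤w'

  Inserts⇒EAligned : ∀ {v w} → Inserts v w → EAligned v w
  Inserts⇒EAligned [] = [] , [] , [] , [] , []
  Inserts⇒EAligned (keep {x = x} v⊑w) =
    let v' , w' , ev , ew , v'≤w' = Inserts⇒EAligned v⊑w in
    just x ∷ v' , just x ∷ w' , keep ev , keep ew , refl-A x ∷ v'≤w'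
  Inserts⇒EAligned (ins {x = x} v⊑w) =
    let v' , w' , ev , ew , v'≤w' = Inserts⇒EAligned v⊑w in
    e ∷ v' , just x ∷ w' , ins ev , keep ew , e≤ (just x) ∷ v'≤w'

  EAligned⇔Inserts : ∀ {v w : List A} → EAligned v w ⇔ Inserts v w
  EAligned⇔Inserts = mk⇔
    (λ (_ , _ , ev , ew , v'≤w') → EAligned⇒Inserts ev ew v'≤w')
    Inserts⇒EAligned

mainTheorem8 : ∀ {a : Level} (A : Set a) (v w : List A) →
    (v ≤ₑ w) ⇔ (v ≤ₘ w)
mainTheorem8 A v w = ⇔-trans ≤ₑ⇔EAligned EAligned⇔Inserts
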